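{- Let $k \ge 3$ be an odd integer and let $D$ be a $k$-quasi-transitive digraph. If $P = (u_0, u_1, \dots, u_{k+1}, u_{k+2})$ is a $u_0u_{k+2}$-path of minimum length in $D$ (so $d(u_0,u_{k+2}) = k+2$), then $d^+(u_{k+1}) \ge d^+(u_0) + \frac{k-1}{2}$.
   Context: All digraphs are finite, without loops and without multiple arcs in the same direction; paths are directed. $d(u,v)$ is the length of a shortest directed $uv$-path; $d^+(x)$ is the out-degree of $x$ in $D$. $D$ is $k$-quasi-transitive if for every directed path $(v_0, \dots, v_k)$ of length $k$, $(v_0,v_k) \in A(D)$ or $(v_k,v_0) \in A(D)$. -}

module Defs where

open import Data.Nat using (ℕ; zero; suc; _+_; _<_)
open import Data.Fin using (Fin; zero; suc; inject₁; fromℕ)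
open import Data.Bool using (Bool; true; false; T)
open import Data.List using (List; length; filter)
open import Data.Fin.Properties using (all?)
open import Data.List using () renaming (map to lmap)
open import Data.List.Base using ()
open import Data.Product using (Σ; _×_; _,_)
open import Data.Sum using (_⊎_)
open import Relation.Nullary using (¬_)
open import Relation.Nullary.Decidable using (does)
open import Relation.Binary.PropositionalEquality using (_≡_; _≢_)
open import Function.Definitions using (Injective)
open import Data.Vec.Functional using (Vector)
import Data.List as L
open import Data.Fin.Base using (toℕ)

-- A finite digraph on vertex set Fin n: arc relation as a Boolean matrix,
-- loopless (no arc (v,v)); at most one arc per direction is automatic.
record Digraph : Set where
  field
    n     : ℕ
    arc   : Fin n → Fin n → Bool
    loopless : ∀ v → arc v v ≡ false

open Digraph public

Arc : (D : Digraph) → Fin (n D) → Fin (n D) → Set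
Arc D u v = T (arc D u v)

IsWalk : (D : Digraph) (m : ℕ) → (Fin (suc m) → Fin (n D)) → Set
IsWalk D m w = (i : Fin m) → Arc D (w (inject₁ i)) (w (suc i))

IsPath : (D : Digraph) (m : ℕ) → (Fin (suc m) → Fin (n D)) → Set
IsPath D m w = IsWalk D m w × Injective _≡_ _≡_ w

PathOfLength : (D : Digraph) (m : ℕ) (u v : Fin (n D)) → Set
PathOfLength D m u v =
  Σ (Fin (suc m) → Fin (n D)) λ w → IsPath D m w × (w zero ≡ u) × (w (fromℕ m) ≡ v)

Dist : (D : Digraph) (u v : Fin (n D)) (m : ℕ) → Set
Dist D u v m = PathOfLength D m u v × (∀ j → j < m → ¬ PathOfLength D j u v)

outdeg : (D : Digraph) → Fin (n D) → ℕ
outdeg D x = length (filter (λ y → Data.Bool._≟_ (arc D x y) true) (L.allFin (n D)))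

QuasiTransitive : ℕ → Digraph → Set
QuasiTransitive k D = ∀ (w : Fin (suc k) → Fin (n D)) → IsPath D k w →
  Arc D (w zero) (w (fromℕ k)) ⊎ Arc D (w (fromℕ k)) (w zero)

-- Write P = u₀ u₁ … u_{k+2} and k = 2t + 1. Every k-path assembled from pieces of P
-- has adjacent ends by quasi-transitivity, and the forward orientation is excluded
-- whenever it would shortcut P. This yields u_k → u₀, u_{k+2} → u₂ and u_{k+2} → u₀,
-- then u_{k+1} → u_{k-2}, and, walking u_{k+1} u_{s+2} … u_k u₀ … u_s, the step from
-- u_{k+1} → u_{s+2} to u_{k+1} → u_s; hence u_{k+1} → u_i for every odd i ≤ k − 2.
-- So u_{k+1} dominates every out-neighbour z of u₀: u₁ by parity, and z off P via the
-- k-path u_{k+1} u₃ … u_k u₀ z (u_{k+1} u_{k+2} u₀ z if k = 3), since z → u_{k+1}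
-- would give the short path u₀ z u_{k+1} u_{k+2}. On top of these, u_{k+1} has the t
-- out-neighbours u₃, u₅, …, u_{k-2}, u_{k+2}, none of which is an out-neighbour of u₀.
module Submission where

open import Defs
open import Data.Bool using (true; T)
import Data.Bool
open import Data.Bool.Properties using (T-≡)
open import Data.Empty using (⊥; ⊥-elim)
open import Data.Fin using (Fin; zero; suc; inject₁; fromℕ; toℕ)
open import Data.Fin.Properties using (toℕ≤pred[n]; injective⇒≤; any?) renaming (_≟_ to _≟ᶠ_)
open import Data.List using (List; []; _∷_; _++_; [_]; length; map; filter; allFin; lookup)
open import Data.List.Properties using (length-++; length-map)
open import Data.List.Membership.Propositional using (_∈_; _∉_)
open import Data.List.Membership.Propositional.Properties
  using (∈-lookup; ∈-map⁻; ∈-++⁻; ∈-filter⁺; ∈-filter⁻; ∈-allFin)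
open import Data.List.Relation.Binary.Disjoint.Propositional using (Disjoint)
open import Data.List.Relation.Binary.Subset.Propositional using (_⊆_)
open import Data.List.Relation.Unary.All as All using (All; []; _∷_)
open import Data.List.Relation.Unary.All.Properties
  using (¬Any⇒All¬) renaming (++⁺ to All-++⁺; map⁺ to All-map⁺)
open import Data.List.Relation.Unary.Any using (here; there; index)
open import Data.List.Relation.Unary.Any.Properties using (lookup-index)
open import Data.List.Relation.Unary.Unique.Propositional using (Unique; []; _∷_)
import Data.List.Relation.Unary.Unique.Propositional.Properties as Unique
open import Data.Nat using (ℕ; zero; suc; _+_; _≤_; _<_; z≤n; s≤s; z<s; ⌊_/2⌋)
open import Data.Nat.Properties
open import Data.Nat.Tactic.RingSolver using (solve-∀)
open import Data.Product using (_×_; _,_; proj₁; proj₂; ∃)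
open import Data.Sum using (_⊎_; inj₁; inj₂; map₂)
open import Data.Unit using (⊤; tt)
open import Function using (_∘_; _on_; Equivalence)
open import Relation.Binary.PropositionalEquality
  using (_≡_; _≢_; refl; sym; trans; cong; cong₂; subst; subst₂; module ≡-Reasoning)
open import Relation.Nullary using (¬_; Dec; yes; no)

module _ {A : Set} where

  lookup-injective : ∀ {xs : List A} → Unique xs → ∀ {i j} → lookup xs i ≡ lookup xs j → i ≡ j
  lookup-injective {_ ∷ _} _          {zero}  {zero}  _ = refl
  lookup-injective         (x∉ ∷ _)   {zero}  {suc j} e = ⊥-elim (All.lookup x∉ (∈-lookup j) e)
  lookup-injective         (x∉ ∷ _)   {suc i} {zero}  e = ⊥-elim (All.lookup x∉ (∈-lookup i) (sym e))
  lookup-injective         (_ ∷ xs!)  {suc i} {suc j} e = cong suc (lookup-injective xs! e)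

  Unique-⊆⇒length≤ : ∀ {xs ys : List A} → Unique xs → xs ⊆ ys → length xs ≤ length ys
  Unique-⊆⇒length≤ {xs} {ys} xs! xs⊆ys = injective⇒≤ position-injective
    where
    position : Fin (length xs) → Fin (length ys)
    position i = index (xs⊆ys (∈-lookup i))
    position-injective : ∀ {i j} → position i ≡ position j → i ≡ j
    position-injective {i} {j} e = lookup-injective xs! (begin
      lookup xs i              ≡⟨ lookup-index (xs⊆ys (∈-lookup i)) ⟩
      lookup ys (position i)   ≡⟨ cong (lookup ys) e ⟩
      lookup ys (position j)   ≡⟨ lookup-index (xs⊆ys (∈-lookup j)) ⟨
      lookup xs j              ∎)
      where open ≡-Reasoning

Walk : {A : Set} → (A → A → Set) → A → List A → Set
Walk R x []       = ⊤
Walk R x (y ∷ ys) = R x y × Walk R y ys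

end : {A : Set} → A → List A → A
end x []       = x
end x (y ∷ ys) = end y ys

module _ {A : Set} where

  end-++ : ∀ x (xs ys : List A) → end x (xs ++ ys) ≡ end (end x xs) ys
  end-++ x []       ys = refl
  end-++ x (y ∷ xs) ys = end-++ y xs ys

  end-map : ∀ {B : Set} (f : B → A) x xs → end (f x) (map f xs) ≡ f (end x xs)
  end-map f x []       = refl
  end-map f x (y ∷ xs) = end-map f y xs

module _ {A : Set} {R : A → A → Set} where

  Walk-++ : ∀ {x} xs {ys} → Walk R x xs → Walk R (end x xs) ys → Walk R x (xs ++ ys)
  Walk-++ []       _         w = w
  Walk-++ (y ∷ xs) (r , w₁) w₂ = r , Walk-++ xs w₁ w₂

  Walk-map : ∀ {B : Set} {f : B → A} {x} xs → Walk (R on f) x xs → Walk R (f x) (map f xs)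
  Walk-map []       _       = tt
  Walk-map (y ∷ xs) (r , w) = r , Walk-map xs w

Adjacent : (D : Digraph) → Fin (n D) → Fin (n D) → Set
Adjacent D x y = Arc D x y ⊎ Arc D y x

record SimpleWalk (D : Digraph) (x : Fin (n D)) (xs : List (Fin (n D))) : Set where
  constructor _,_
  field
    walk   : Walk (Arc D) x xs
    unique : Unique (x ∷ xs)

module DigraphProperties (D : Digraph) where

  private
    V = Fin (n D)

  Arc-irreflexive : ∀ {x} → ¬ Arc D x x
  Arc-irreflexive {x} = subst T (loopless D x)

  Adjacent⇒reverse : ∀ {x y} → Adjacent D x y → ¬ Arc D x y → Arc D y x
  Adjacent⇒reverse (inj₁ xy) ¬xy = ⊥-elim (¬xy xy)
  Adjacent⇒reverse (inj₂ yx) _   = yx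

  Adjacent⇒forward : ∀ {x y} → Adjacent D x y → ¬ Arc D y x → Arc D x y
  Adjacent⇒forward (inj₁ xy) _   = xy
  Adjacent⇒forward (inj₂ yx) ¬yx = ⊥-elim (¬yx yx)

  SimpleWalk⇒Path : ∀ {x xs} → SimpleWalk D x xs → PathOfLength D (length xs) x (end x xs)
  SimpleWalk⇒Path {x} {xs} (w , x∷xs!) =
    lookup (x ∷ xs) , (lookup-IsWalk x xs w , lookup-injective x∷xs!) , refl , lookup-end x xs
    where
    lookup-IsWalk : ∀ x xs → Walk (Arc D) x xs → IsWalk D (length xs) (lookup (x ∷ xs))
    lookup-IsWalk x (y ∷ ys) (xy , _) zero    = xy
    lookup-IsWalk x (y ∷ ys) (_  , w) (suc i) = lookup-IsWalk y ys w i
    lookup-end : ∀ x xs → lookup (x ∷ xs) (fromℕ (length xs)) ≡ end x xs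
    lookup-end x []       = refl
    lookup-end x (y ∷ ys) = lookup-end y ys

  SimpleWalk-∷ʳ : ∀ {x xs z} → SimpleWalk D x xs → Arc D (end x xs) z → z ∉ x ∷ xs →
    SimpleWalk D x (xs ++ [ z ])
  SimpleWalk-∷ʳ {x} {xs} (w , x∷xs!) a z∉ =
    Walk-++ xs w (a , tt) , Unique.++⁺ x∷xs! ([] ∷ []) λ { (z∈ , here refl) → z∉ z∈ }

  QuasiTransitive⇒Adjacent : ∀ {k x xs} → QuasiTransitive k D → SimpleWalk D x xs → length xs ≡ k →
    Adjacent D x (end x xs)
  QuasiTransitive⇒Adjacent qt sw refl with w , w-path , w₀ , wₖ ← SimpleWalk⇒Path sw =
    subst₂ (Adjacent D) w₀ wₖ (qt w w-path)

  isOutNeighbour? : (x y : V) → Dec (arc D x y ≡ true)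
  isOutNeighbour? x y = arc D x y Data.Bool.≟ true

  outNeighbours : V → List V
  outNeighbours x = filter (isOutNeighbour? x) (allFin (n D))

  ∈-outNeighbours⁺ : ∀ {x y} → Arc D x y → y ∈ outNeighbours x
  ∈-outNeighbours⁺ {y = y} xy = ∈-filter⁺ (isOutNeighbour? _) (∈-allFin y) (Equivalence.to T-≡ xy)

  ∈-outNeighbours⁻ : ∀ {x y} → y ∈ outNeighbours x → Arc D x y
  ∈-outNeighbours⁻ y∈ =
    Equivalence.from T-≡ (proj₂ (∈-filter⁻ (isOutNeighbour? _) {xs = allFin (n D)} y∈))

  outdeg+length≤outdeg : ∀ {x y} {zs : List V} → (∀ {z} → Arc D x z → Arc D y z) →
    Unique zs → All (λ z → Arc D y z × ¬ Arc D x z) zs → outdeg D x + length zs ≤ outdeg D y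
  outdeg+length≤outdeg {x} {y} {zs} N⁺x⊆N⁺y zs! zs-new = begin
    outdeg D x + length zs              ≡⟨ +-comm (outdeg D x) (length zs) ⟩
    length zs + outdeg D x              ≡⟨ length-++ zs ⟨
    length (zs ++ outNeighbours x)      ≤⟨ Unique-⊆⇒length≤ zs++N⁺x! zs++N⁺x⊆N⁺y ⟩
    outdeg D y                          ∎
    where
    open ≤-Reasoning
    zs++N⁺x! : Unique (zs ++ outNeighbours x)
    zs++N⁺x! = Unique.++⁺ zs! (Unique.filter⁺ _ (Unique.allFin⁺ (n D)))
      λ (z∈zs , z∈N⁺x) → proj₂ (All.lookup zs-new z∈zs) (∈-outNeighbours⁻ z∈N⁺x)
    zs++N⁺x⊆N⁺y : zs ++ outNeighbours x ⊆ outNeighbours y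
    zs++N⁺x⊆N⁺y z∈ with ∈-++⁻ zs z∈
    ... | inj₁ z∈zs  = ∈-outNeighbours⁺ (proj₁ (All.lookup zs-new z∈zs))
    ... | inj₂ z∈N⁺x = ∈-outNeighbours⁺ (N⁺x⊆N⁺y (∈-outNeighbours⁻ z∈N⁺x))

range : ℕ → ℕ → List ℕ
range a zero    = []
range a (suc m) = a ∷ range (suc a) m

length-range : ∀ a m → length (range a m) ≡ m
length-range a zero    = refl
length-range a (suc m) = cong suc (length-range (suc a) m)

end-range : ∀ a m → end a (range (suc a) m) ≡ a + m
end-range a zero    = sym (+-identityʳ a)
end-range a (suc m) = trans (end-range (suc a) m) (sym (+-suc a m))

length-range-++ : ∀ a m b n → length (range a m ++ range b n) ≡ m + n
length-range-++ a m b n = trans (length-++ (range a m)) (cong₂ _+_ (length-range a m) (length-range b n))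

range-bounds : ∀ {a m i} → i ∈ range a m → a ≤ i × i < a + m
range-bounds {a} {suc m} (here refl) = ≤-refl , m<m+n a z<s
range-bounds {a} {suc m} {i} (there i∈) with a<i , i<1+a+m ← range-bounds i∈ =
  <⇒≤ a<i , subst (i <_) (sym (+-suc a m)) i<1+a+m

∉-range : ∀ {a m i} → i < a ⊎ a + m ≤ i → i ∉ range a m
∉-range (inj₁ i<a)   i∈ = <⇒≱ i<a (proj₁ (range-bounds i∈))
∉-range (inj₂ a+m≤i) i∈ = <⇒≱ (proj₂ (range-bounds i∈)) a+m≤i

range-unique : ∀ a m → Unique (range a m)
range-unique a zero    = []
range-unique a (suc m) = ¬Any⇒All¬ _ (∉-range (inj₁ ≤-refl)) ∷ range-unique (suc a) m

range-disjoint : ∀ {a m b n} → a + m ≤ b ⊎ b + n ≤ a → Disjoint (range a m) (range b n)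
range-disjoint (inj₁ a+m≤b) (i∈₁ , i∈₂) =
  ∉-range (inj₁ (<-≤-trans (proj₂ (range-bounds i∈₁)) a+m≤b)) i∈₂
range-disjoint (inj₂ b+n≤a) (i∈₁ , i∈₂) =
  ∉-range (inj₂ (≤-trans b+n≤a (proj₁ (range-bounds i∈₁)))) i∈₂

range-≤ : ∀ {a m b} → a + m ≤ suc b → All (_≤ b) (range a m)
range-≤ a+m≤1+b = All.tabulate λ i∈ → ≤-pred (<-≤-trans (proj₂ (range-bounds i∈)) a+m≤1+b)

-- A shortest path in a k-quasi-transitive digraph

-- Totalises indexing into Fin (suc m); indices beyond m are sent to zero.
clamp : (m : ℕ) → ℕ → Fin (suc m)
clamp m       zero    = zero
clamp zero    (suc i) = zero
clamp (suc m) (suc i) = suc (clamp m i)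

toℕ-clamp : ∀ {m i} → i ≤ m → toℕ (clamp m i) ≡ i
toℕ-clamp {m}     {zero}  _         = refl
toℕ-clamp {suc m} {suc i} (s≤s i≤m) = cong suc (toℕ-clamp i≤m)

clamp-toℕ : ∀ {m} (f : Fin (suc m)) → clamp m (toℕ f) ≡ f
clamp-toℕ         zero    = refl
clamp-toℕ {suc m} (suc f) = cong suc (clamp-toℕ f)

clamp-fromℕ : ∀ m → clamp m m ≡ fromℕ m
clamp-fromℕ zero    = refl
clamp-fromℕ (suc m) = cong suc (clamp-fromℕ m)

inject₁-clamp : ∀ {m i} → i ≤ m → inject₁ (clamp m i) ≡ clamp (suc m) i
inject₁-clamp {m}     {zero}  _         = refl
inject₁-clamp {suc m} {suc i} (s≤s i≤m) = cong suc (inject₁-clamp i≤m)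

module ShortestPath {k : ℕ} {D : Digraph} (qt : QuasiTransitive k D)
  (u : Fin (3 + k) → Fin (n D)) (u-path : IsPath D (2 + k) u)
  (u-shortest : Dist D (u zero) (u (fromℕ (2 + k))) (2 + k)) where

  open DigraphProperties D

  M : ℕ
  M = 2 + k

  U : ℕ → Fin (n D)
  U i = u (clamp M i)

  Step : ℕ → ℕ → Set
  Step i j = Arc D (U i) (U j)

  OffPath : Fin (n D) → Set
  OffPath z = ∀ f → z ≢ u f

  U-injective : ∀ {i j} → i ≤ M → j ≤ M → U i ≡ U j → i ≡ j
  U-injective {i} {j} i≤M j≤M e = begin
    i                ≡⟨ toℕ-clamp i≤M ⟨
    toℕ (clamp M i)  ≡⟨ cong toℕ (proj₂ u-path e) ⟩
    toℕ (clamp M j)  ≡⟨ toℕ-clamp j≤M ⟩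
    j                ∎
    where open ≡-Reasoning

  U-step : ∀ {i} → i < M → Step i (suc i)
  U-step {i} (s≤s i≤1+k) =
    subst (λ f → Arc D (u f) (U (suc i))) (inject₁-clamp i≤1+k) (proj₁ u-path (clamp (suc k) i))

  Unique-map-U : ∀ {is} → Unique is → All (_≤ M) is → Unique (map U is)
  Unique-map-U []         []           = []
  Unique-map-U (i∉ ∷ is!) (i≤M ∷ is≤M) =
    All-map⁺ (All.zipWith (λ (i≢j , j≤M) → i≢j ∘ U-injective i≤M j≤M) (i∉ , is≤M)) ∷ Unique-map-U is! is≤M

  along : ∀ {p q} → p + q ≤ M → Walk Step p (range (suc p) q)
  along {p} {zero}  _       = tt
  along {p} {suc q} p+q+1≤M =
    U-step (<-≤-trans (m<m+n p z<s) p+q+1≤M) , along (subst (_≤ M) (+-suc p q) p+q+1≤M)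

  alongThen : ∀ {p q y rest} → p + q ≤ M → Step (p + q) y → Walk Step y rest →
    Walk Step p (range (suc p) q ++ y ∷ rest)
  alongThen {p} {q} p+q≤M jump w =
    Walk-++ (range (suc p) q) (along p+q≤M) (subst (λ i → Step i _) (sym (end-range p q)) jump , w)

  record IndexPath (x : ℕ) (is : List ℕ) : Set where
    constructor indexPath
    field
      walk    : Walk Step x is
      unique  : Unique (x ∷ is)
      bounded : All (_≤ M) (x ∷ is)

  IndexPath⇒SimpleWalk : ∀ {x is} → IndexPath x is → SimpleWalk D (U x) (map U is)
  IndexPath⇒SimpleWalk {is = is} p = Walk-map {R = Arc D} is walk , Unique-map-U unique bounded
    where open IndexPath p

  IndexPath⇒Adjacent : ∀ {x is} → IndexPath x is → length is ≡ k → Adjacent D (U x) (U (end x is))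
  IndexPath⇒Adjacent {x} {is} p len = subst (Adjacent D (U x)) (end-map U x is)
    (QuasiTransitive⇒Adjacent qt (IndexPath⇒SimpleWalk p) (trans (length-map U is) len))

  noShortcut : ∀ {xs} → SimpleWalk D (U 0) xs → end (U 0) xs ≡ U M → length xs < M → ⊥
  noShortcut sw ends short = proj₂ u-shortest _ short
    (subst (PathOfLength D _ (u zero)) (trans ends (cong u (clamp-fromℕ M))) (SimpleWalk⇒Path sw))

  IndexPath-noShortcut : ∀ {is} → IndexPath 0 is → end 0 is ≡ M → length is < M → ⊥
  IndexPath-noShortcut {is} p ends short =
    noShortcut (IndexPath⇒SimpleWalk p) (trans (end-map U 0 is) (cong U ends))
      (subst (_< M) (sym (length-map U is)) short)

  noForwardArc : ∀ {a b} → suc a < b → b ≤ M → ¬ Step a b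
  noForwardArc {a} {b} a+1<b b≤M ab with c , b+c≡M ← m≤n⇒∃[o]m+o≡n b≤M =
    IndexPath-noShortcut detour ends shorter
    where
    a≤M : a ≤ M
    a≤M = ≤-trans (m≤n+m a 2) (≤-trans a+1<b b≤M)
    detour : IndexPath 0 (range 1 a ++ range b (suc c))
    detour = indexPath
      (alongThen a≤M ab (along (≤-reflexive b+c≡M)))
      (Unique.++⁺ (range-unique 0 (suc a)) (range-unique b (suc c)) (range-disjoint (inj₁ (<⇒≤ a+1<b))))
      (All-++⁺ (range-≤ {0} {suc a} (s≤s a≤M))
               (range-≤ {b} {suc c} (≤-reflexive (trans (+-suc b c) (cong suc b+c≡M)))))
    ends : end 0 (range 1 a ++ range b (suc c)) ≡ M
    ends = trans (end-++ 0 (range 1 a) _) (trans (end-range b c) b+c≡M)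
    shorter : length (range 1 a ++ range b (suc c)) < M
    shorter = begin-strict
      length (range 1 a ++ range b (suc c))  ≡⟨ length-range-++ 1 a b (suc c) ⟩
      a + suc c                              ≡⟨ +-suc a c ⟩
      suc a + c                              <⟨ +-monoˡ-< c a+1<b ⟩
      b + c                                  ≡⟨ b+c≡M ⟩
      M                                      ∎
      where open ≤-Reasoning

  backArc : ∀ {a} → 2 ≤ k → a + k ≤ M → Step (a + k) a
  backArc {a} 2≤k a+k≤M = Adjacent⇒reverse adjacent (noForwardArc a+1<a+k a+k≤M)
    where
    subpath : IndexPath a (range (suc a) k)
    subpath = indexPath (along a+k≤M) (range-unique a (suc k))
      (range-≤ {a} {suc k} (subst (_≤ suc M) (sym (+-suc a k)) (s≤s a+k≤M)))
    adjacent : Adjacent D (U a) (U (a + k))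
    adjacent = subst (λ i → Adjacent D (U a) (U i)) (end-range a k)
      (IndexPath⇒Adjacent subpath (length-range (suc a) k))
    a+1<a+k : suc a < a + k
    a+1<a+k = subst (_≤ a + k) (+-comm a 2) (+-monoʳ-≤ a 2≤k)

  -- u_x u_p … u_{p+q} u₀ … u_r
  wrapPath : ∀ {x p q r} → r < p → x < p ⊎ p + q < x → r < x → x ≤ M → p + q ≤ M →
    Step x p → Step (p + q) 0 → IndexPath x (range p (suc q) ++ range 0 (suc r))
  wrapPath {x} {p} {q} {r} r<p x∉[p,p+q] r<x x≤M p+q≤M x→p p+q→0 = indexPath
    (x→p , alongThen p+q≤M p+q→0 (along r≤M))
    (¬Any⇒All¬ _ x∉ ∷
      Unique.++⁺ (range-unique p (suc q)) (range-unique 0 (suc r)) (range-disjoint (inj₂ r<p)))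
    (x≤M ∷ All-++⁺ (range-≤ {p} {suc q} (subst (_≤ suc M) (sym (+-suc p q)) (s≤s p+q≤M)))
                   (range-≤ {0} {suc r} (s≤s r≤M)))
    where
    r≤M : r ≤ M
    r≤M = ≤-trans (<⇒≤ r<p) (≤-trans (m≤m+n p q) p+q≤M)
    x∉ : x ∉ range p (suc q) ++ range 0 (suc r)
    x∉ x∈ with ∈-++⁻ (range p (suc q)) x∈
    ... | inj₁ x∈₁ = ∉-range (map₂ (subst (_≤ x) (sym (+-suc p q))) x∉[p,p+q]) x∈₁
    ... | inj₂ x∈₂ = ∉-range (inj₂ r<x) x∈₂

  end-wrap : ∀ x p q r → end x (range p (suc q) ++ range 0 (suc r)) ≡ r
  end-wrap x p q r = trans (end-++ x (range p (suc q)) _) (end-range 0 r)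

  wrapAdjacent : ∀ {x p q r} → r < p → x < p ⊎ p + q < x → r < x → x ≤ M → p + q ≤ M →
    Step x p → Step (p + q) 0 → suc q + suc r ≡ k → Adjacent D (U x) (U r)
  wrapAdjacent {x} {p} {q} {r} r<p x∉ r<x x≤M p+q≤M x→p p+q→0 len =
    subst (λ i → Adjacent D (U x) (U i)) (end-wrap x p q r)
      (IndexPath⇒Adjacent (wrapPath r<p x∉ r<x x≤M p+q≤M x→p p+q→0)
        (trans (length-range-++ p (suc q) 0 (suc r)) len))

  arcLastFirst : ∀ {q} → 2 + q ≡ k → Step M 0
  arcLastFirst {q} 2+q≡k = Adjacent⇒forward
    (wrapAdjacent z<s (inj₂ 2+q<M) z<s ≤-refl (<⇒≤ 2+q<M) (backArc 2≤k ≤-refl) k→0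
      (trans (+-comm (suc q) 1) 2+q≡k))
    (noForwardArc (s≤s (s≤s z≤n)) ≤-refl)
    where
    2≤k : 2 ≤ k
    2≤k = subst (2 ≤_) 2+q≡k (m≤m+n 2 q)
    2+q<M : 2 + q < M
    2+q<M = s≤s (m≤n⇒m≤1+n (≤-reflexive 2+q≡k))
    k→0 : Step (2 + q) 0
    k→0 = subst (λ i → Step i 0) (sym 2+q≡k) (backArc 2≤k (m≤n+m k 2))

  arcFromPenultimate : ∀ {i} → i + 2 ≡ k → Step (suc k) i
  arcFromPenultimate {i} i+2≡k = Adjacent⇒forward
    (wrapAdjacent {suc k} {M} {0} {i} (m≤n⇒m≤1+n (m≤n⇒m≤1+n i<k)) (inj₁ ≤-refl) (m≤n⇒m≤1+n i<k)
      (n≤1+n (suc k)) (≤-reflexive (+-identityʳ M)) (U-step ≤-refl) M→0 2+i≡k)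
    (noForwardArc (s≤s i<k) (n≤1+n (suc k)))
    where
    2+i≡k : 2 + i ≡ k
    2+i≡k = trans (+-comm 2 i) i+2≡k
    i<k : i < k
    i<k = ≤-trans (n≤1+n (suc i)) (≤-reflexive 2+i≡k)
    M→0 : Step (M + 0) 0
    M→0 = subst (λ j → Step j 0) (sym (+-identityʳ M)) (arcLastFirst 2+i≡k)

  arcFromPenultimate-descend : ∀ {s q} → s + 2 + q ≡ k → Step (suc k) (s + 2) → Step (suc k) s
  arcFromPenultimate-descend {s} {q} s+2+q≡k 1+k→s+2 = Adjacent⇒forward
    (wrapAdjacent {suc k} {s + 2} {q} {s} (m<m+n s z<s) (inj₂ (s≤s s+2+q≤k)) (m≤n⇒m≤1+n s<k)
      (n≤1+n (suc k)) (m≤n⇒m≤1+n (m≤n⇒m≤1+n s+2+q≤k)) 1+k→s+2 k→0 len)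
    (noForwardArc (s≤s s<k) (n≤1+n (suc k)))
    where
    s+2+q≤k : s + 2 + q ≤ k
    s+2+q≤k = ≤-reflexive s+2+q≡k
    s<k : s < k
    s<k = <-≤-trans (m<m+n s z<s) (≤-trans (m≤m+n (s + 2) q) s+2+q≤k)
    2≤k : 2 ≤ k
    2≤k = ≤-trans (m≤n+m 2 s) (≤-trans (m≤m+n (s + 2) q) s+2+q≤k)
    k→0 : Step (s + 2 + q) 0
    k→0 = subst (λ i → Step i 0) (sym s+2+q≡k) (backArc 2≤k (m≤n+m k 2))
    len : suc q + suc s ≡ k
    len = trans (lemma s q) s+2+q≡k
      where
      lemma : ∀ s q → suc q + suc s ≡ s + 2 + q
      lemma = solve-∀

  arcFromPenultimate-parity : ∀ m {i} → i + (m + m) + 2 ≡ k → Step (suc k) i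
  arcFromPenultimate-parity zero    {i} e =
    arcFromPenultimate (trans (cong (_+ 2) (sym (+-identityʳ i))) e)
  arcFromPenultimate-parity (suc m) {i} e =
    arcFromPenultimate-descend (trans (shift₁ i m) e) (arcFromPenultimate-parity m (trans (shift₂ i m) e))
    where
    shift₁ : ∀ i m → i + 2 + (m + m + 2) ≡ i + (suc m + suc m) + 2
    shift₁ = solve-∀
    shift₂ : ∀ i m → i + 2 + (m + m) + 2 ≡ i + (suc m + suc m) + 2
    shift₂ = solve-∀

  U-≢ : ∀ {i j} → i ≤ M → j ≤ M → i ≢ j → U i ≢ U j
  U-≢ i≤M j≤M i≢j = i≢j ∘ U-injective i≤M j≤M

  noReturn : ∀ {z} → 2 ≤ k → OffPath z → Arc D (U 0) z → ¬ Arc D z (U (suc k))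
  noReturn {z} 2≤k off 0→z z→1+k = noShortcut (walk , unique) refl (s≤s (s≤s 2≤k))
    where
    walk : Walk (Arc D) (U 0) (z ∷ U (suc k) ∷ U M ∷ [])
    walk = 0→z , z→1+k , U-step ≤-refl , tt
    unique : Unique (U 0 ∷ z ∷ U (suc k) ∷ U M ∷ [])
    unique = ((λ e → off _ (sym e)) ∷ U-≢ z≤n (n≤1+n (suc k)) (λ ()) ∷ U-≢ z≤n ≤-refl (λ ()) ∷ [])
           ∷ (off _ ∷ off _ ∷ [])
           ∷ (U-≢ (n≤1+n (suc k)) ≤-refl (<⇒≢ ≤-refl) ∷ [])
           ∷ [] ∷ []

  offPathNeighbour : ∀ {z ws} → 2 ≤ k →
    IndexPath (suc k) ws → end (suc k) ws ≡ 0 → suc (length ws) ≡ k →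
    OffPath z → Arc D (U 0) z → Arc D (U (suc k)) z
  offPathNeighbour {z} {ws} 2≤k p ends len off 0→z = Adjacent⇒forward adjacent (noReturn 2≤k off 0→z)
    where
    end→z : Arc D (end (U (suc k)) (map U ws)) z
    end→z = subst (λ v → Arc D v z) (sym (trans (end-map U (suc k) ws) (cong U ends))) 0→z
    z∉ : z ∉ map U (suc k ∷ ws)
    z∉ z∈ with i , _ , z≡Ui ← ∈-map⁻ U z∈ = off (clamp M i) z≡Ui
    len′ : length (map U ws ++ [ z ]) ≡ k
    len′ = trans (length-++ (map U ws)) (trans (+-comm _ 1) (trans (cong suc (length-map U ws)) len))
    adjacent : Adjacent D (U (suc k)) z
    adjacent = subst (Adjacent D _) (end-++ (U (suc k)) (map U ws) [ z ])
      (QuasiTransitive⇒Adjacent qt (SimpleWalk-∷ʳ (IndexPath⇒SimpleWalk p) end→z z∉) len′)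

  -- Odd k = 2t + 1

  arcFromPenultimate-odd : ∀ {t j} → suc (t + t) ≡ k → j < t → Step (suc k) (suc (j + j))
  arcFromPenultimate-odd {t} {j} k-odd j<t with m , 1+j+m≡t ← m≤n⇒∃[o]m+o≡n j<t =
    arcFromPenultimate-parity m (trans (lemma j m) (trans (cong (λ x → suc (x + x)) 1+j+m≡t) k-odd))
    where
    lemma : ∀ j m → suc (j + j) + (m + m) + 2 ≡ suc ((suc j + m) + (suc j + m))
    lemma = solve-∀

  penultimateToFirstPath : ∀ {t} → suc (t + t) ≡ k → 1 ≤ t →
    ∃ λ ws → IndexPath (suc k) ws × end (suc k) ws ≡ 0 × suc (length ws) ≡ k
  penultimateToFirstPath {t} k-odd 1≤t with m≤n⇒∃[o]m+o≡n 1≤t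
  ... | zero , 1≡t = _ ,
    wrapPath {suc k} {M} {0} {0} z<s (inj₁ ≤-refl) z<s (n≤1+n (suc k)) (≤-reflexive (+-identityʳ M))
      (U-step ≤-refl) (subst (λ i → Step i 0) (sym (+-identityʳ M)) (arcLastFirst 3≡k)) ,
    end-wrap (suc k) M 0 0 , 3≡k
    where
    3≡k : 3 ≡ k
    3≡k = trans (cong (λ x → suc (x + x)) 1≡t) k-odd
  ... | suc o , 2+o≡t = _ ,
    wrapPath {suc k} {3} {q} {0} z<s (inj₂ (s≤s 3+q≤k)) z<s (n≤1+n (suc k)) (≤-trans 3+q≤k (m≤n+m k 2))
      (arcFromPenultimate-odd k-odd (subst (2 ≤_) 2+o≡t (s≤s (s≤s z≤n))))
      (subst (λ i → Step i 0) (sym 3+q≡k) (backArc (≤-trans (m≤m+n 2 (suc q)) 3+q≤k) (m≤n+m k 2))) ,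
    end-wrap (suc k) 3 q 0 ,
    trans (cong suc (length-range-++ 3 (suc q) 0 1)) (trans (cong (2 +_) (+-comm q 1)) 3+q≡k)
    where
    q : ℕ
    q = o + suc (suc o)  -- k − 3
    3+q≡k : 3 + q ≡ k
    3+q≡k = trans (cong (λ x → suc (x + x)) 2+o≡t) k-odd
    3+q≤k : 3 + q ≤ k
    3+q≤k = ≤-reflexive 3+q≡k

  inheritsOutNeighbours : ∀ {t z} → suc (t + t) ≡ k → 1 ≤ t → Arc D (U 0) z → Arc D (U (suc k)) z
  inheritsOutNeighbours {t} {z} k-odd 1≤t 0→z with any? (λ f → z ≟ᶠ u f)
  ... | yes (f , refl) = onPath f 0→z
    where
    onPath : ∀ f → Arc D (U 0) (u f) → Arc D (U (suc k)) (u f)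
    onPath zero          0→0 = ⊥-elim (Arc-irreflexive 0→0)
    onPath (suc zero)    _   = arcFromPenultimate-odd k-odd 1≤t
    onPath (suc (suc f)) 0→f = ⊥-elim (noForwardArc (s≤s (s≤s z≤n)) (s≤s (s≤s (toℕ≤pred[n] f)))
      (subst (λ g → Arc D (U 0) (u (suc (suc g)))) (sym (clamp-toℕ f)) 0→f))
  ... | no z∉P with ws , p , ends , len ← penultimateToFirstPath k-odd 1≤t =
    offPathNeighbour (subst (2 ≤_) k-odd (s≤s (≤-trans 1≤t (m≤m+n t t)))) p ends len
      (λ f z≡uf → z∉P (f , z≡uf)) 0→z

  outdeg-gain : ∀ {t} → suc (t + t) ≡ k → 1 ≤ t → outdeg D (U 0) + t ≤ outdeg D (U (suc k))
  outdeg-gain {suc t} k-odd 1≤t =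
    subst (λ l → outdeg D (U 0) + l ≤ outdeg D (U (suc k))) length-new
    (outdeg+length≤outdeg (inheritsOutNeighbours k-odd 1≤t) (Unique-map-U new! new≤M) (All-map⁺ new-arcs))
    where
    odd : ℕ → ℕ
    odd j = suc (j + j)
    odd-injective : ∀ {i j} → odd i ≡ odd j → i ≡ j
    odd-injective {i} {j} e =
      trans (n≡⌊n+n/2⌋ i) (trans (cong ⌊_/2⌋ (suc-injective e)) (sym (n≡⌊n+n/2⌋ j)))
    odd<k : ∀ {j} → j ≤ t → odd j < k
    odd<k j≤t = subst (_ <_) k-odd (s≤s (s≤s (+-mono-≤ j≤t (m≤n⇒m≤1+n j≤t))))
    new : List ℕ
    new = M ∷ map odd (range 1 t)
    length-new : length (map U new) ≡ suc t
    length-new = trans (length-map U new) (cong suc (trans (length-map odd (range 1 t)) (length-range 1 t)))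
    new! : Unique new
    new! = ¬Any⇒All¬ _ M∉ ∷ Unique.map⁺ odd-injective (range-unique 1 t)
      where
      M∉ : M ∉ map odd (range 1 t)
      M∉ M∈ with j , j∈ , M≡odd-j ← ∈-map⁻ odd M∈ =
        <⇒≢ (<-≤-trans (odd<k (≤-pred (proj₂ (range-bounds j∈)))) (m≤n+m k 2)) (sym M≡odd-j)
    new≤M : All (_≤ M) new
    new≤M = ≤-refl ∷ All-map⁺ (All.tabulate λ j∈ →
      ≤-trans (<⇒≤ (odd<k (≤-pred (proj₂ (range-bounds j∈))))) (m≤n+m k 2))
    new-arcs : All (λ i → Arc D (U (suc k)) (U i) × ¬ Arc D (U 0) (U i)) new
    new-arcs = (U-step ≤-refl , noForwardArc (s≤s (s≤s z≤n)) ≤-refl)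
      ∷ All-map⁺ (All.tabulate λ {j} j∈ → let 1≤j , j<1+t = range-bounds j∈ in
          arcFromPenultimate-odd k-odd j<1+t ,
          noForwardArc (s≤s (≤-trans 1≤j (m≤m+n j j)))
            (≤-trans (<⇒≤ (odd<k (≤-pred j<1+t))) (m≤n+m k 2)))

mainTheorem16 : (t : ℕ) → 1 ≤ t → (D : Digraph) →
    QuasiTransitive (suc (t + t)) D →
    (u : Fin (suc (suc (suc (suc (t + t))))) → Fin (n D)) →
    IsPath D (suc (suc (suc (t + t)))) u →
    Dist D (u zero) (u (fromℕ (suc (suc (suc (t + t)))))) (suc (suc (suc (t + t)))) →
    outdeg D (u zero) + t ≤ outdeg D (u (inject₁ (fromℕ (suc (suc (t + t))))))
mainTheorem16 t 1≤t D qt u u-path u-shortest =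
  subst (λ f → outdeg D (u zero) + t ≤ outdeg D (u f)) clamp-penultimate (outdeg-gain refl 1≤t)
  where
  open ShortestPath {D = D} qt u u-path u-shortest
  clamp-penultimate : clamp M (suc (suc (t + t))) ≡ inject₁ (fromℕ (suc (suc (t + t))))
  clamp-penultimate = trans (sym (inject₁-clamp ≤-refl)) (cong inject₁ (clamp-fromℕ _))
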